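{- For every base $\mathcal{B}$, every finite set $P$ of atoms and every atom $a$: $P \Vdash_{\mathcal{B}} a$ if and only if $P \vdash_{\mathcal{B}} a$.
   Context: Fix a set $\mathrm{At}$ of atoms. An atomic rule has the form $((P_1 \Rightarrow a_1), \dots, (P_n \Rightarrow a_n) \Rightarrow b)$ with $n \ge 0$, atoms $a_i, b$ and finite sets of atoms $P_i$. A base is a set of atomic rules, ordered by inclusion. Derivability $P \vdash_{\mathcal{B}} a$ (finite set of atoms $P$, atom $a$) is defined inductively by (Ref) $P, a \vdash_{\mathcal{B}} a$ and (App) for a rule $((P_1 \Rightarrow a_1),\dots,(P_n \Rightarrow a_n) \Rightarrow b) \in \mathcal{B}$ and finite $Q$, if $Q, P_i \vdash_{\mathcal{B}} a_i$ for all $i$ then $Q \vdash_{\mathcal{B}} b$ (commas denote union). For an atom $a$, support is $\Vdash_{\mathcal{B}} a$ iff $\emptyset \vdash_{\mathcal{B}} a$. For a nonempty set $P$ of atoms, $P \Vdash_{\mathcal{B}} a$ means: for every base $\mathcal{C} \supseteq \mathcal{B}$, if $\Vdash_{\mathcal{C}} p$ for every $p \in P$, then $\Vdash_{\mathcal{C}} a$; for $P = \emptyset$, $P \Vdash_{\mathcal{B}} a$ means $\Vdash_{\mathcal{B}} a$. -}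

module Defs where

open import Data.List using (List; []; _∷_; _++_)
open import Data.List.Membership.Propositional using (_∈_)
open import Data.List.Relation.Unary.All using (All)
open import Data.Product using (_×_; _,_; proj₁; proj₂)
open import Level using (Lift) renaming (suc to lsuc; zero to lzero)

-- Finite sets of atoms are represented by lists (membership is what matters;
-- "commas denote union" becomes list concatenation).

record Rule (At : Set) : Set where
  constructor _⇒_
  field
    premises : List (List At × At)
    conclusion : At
open Rule public

Base : Set → Set₁
Base At = Rule At → Set

_⊆B_ : {At : Set} → Base At → Base At → Set
B ⊆B C = ∀ r → B r → C r

data Der {At : Set} (B : Base At) : List At → At → Set where
  ref : ∀ {P a} → a ∈ P → Der B P a
  app : ∀ {Q} (r : Rule At) → B r →
        All (λ prem → Der B (Q ++ proj₁ prem) (proj₂ prem)) (premises r) →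
        Der B Q (conclusion r)

Supp : {At : Set} → Base At → At → Set
Supp B a = Der B [] a

Forces : {At : Set} → List At → Base At → At → Set₁
Forces [] B a = Lift (lsuc lzero) (Supp B a)
Forces P@(_ ∷ _) B a =
  (C : Base _) → B ⊆B C → All (λ p → Supp C p) P → Supp C a

{-# OPTIONS --safe #-}
-- Soundness: a derivation of a from P in B is also one in every C ⊇ B, and
-- cutting in the C-derivations of the atoms of P turns it into a proof from ∅.
-- Completeness: the extension of B by the axioms (⇒ p), p ∈ P, supports every
-- p ∈ P and hence a; replacing each use of such an axiom in that derivation by
-- the hypothesis p yields P ⊢_B a.
module Submission where

open import Defs
open import Data.List using (List; []; _∷_; _++_)
open import Data.List.Membership.Propositional using (_∈_)
open import Data.List.Properties using (++-assoc; ++-identityʳ)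
open import Data.List.Relation.Binary.Subset.Propositional using (_⊆_)
open import Data.List.Relation.Binary.Subset.Propositional.Properties
  using (++⁺ˡ; xs⊆xs++ys; xs⊆ys++xs)
open import Data.List.Relation.Unary.All as All using (All; []; _∷_)
open import Data.List.Relation.Unary.All.Properties as All using ()
open import Data.Product using (_×_; _,_)
open import Function.Bundles using (_⇔_; mk⇔)
open import Level using (lift; lower)
open import Relation.Binary.PropositionalEquality using (sym; subst)

module _ {At : Set} where

  DerPremises : Base At → List At → List (List At × At) → Set
  DerPremises B Q = All (λ (P , a) → Der B (Q ++ P) a)

  mutual
    weaken : ∀ {B Q Q' a} → Q ⊆ Q' → Der B Q a → Der B Q' a
    weaken Q⊆Q' (ref a∈Q)      = ref (Q⊆Q' a∈Q)
    weaken Q⊆Q' (app r r∈B ds) = app r r∈B (weakenPremises Q⊆Q' ds)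

    weakenPremises : ∀ {B Q Q' ps} → Q ⊆ Q' → DerPremises B Q ps → DerPremises B Q' ps
    weakenPremises Q⊆Q' []                     = []
    weakenPremises Q⊆Q' (_∷_ {x = P , _} d ds) =
      weaken (++⁺ˡ P Q⊆Q') d ∷ weakenPremises Q⊆Q' ds

  mutual
    mono : ∀ {B C Q a} → B ⊆B C → Der B Q a → Der C Q a
    mono B⊆C (ref a∈Q)      = ref a∈Q
    mono B⊆C (app r r∈B ds) = app r (B⊆C r r∈B) (monoPremises B⊆C ds)

    monoPremises : ∀ {B C Q ps} → B ⊆B C → DerPremises B Q ps → DerPremises C Q ps
    monoPremises B⊆C []       = []
    monoPremises B⊆C (d ∷ ds) = mono B⊆C d ∷ monoPremises B⊆C ds

  cut-++ : ∀ {B Q R} P → All (Der B R) Q → All (Der B (R ++ P)) (Q ++ P)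
  cut-++ {R = R} P R⊢Q =
    All.++⁺ (All.map (weaken (xs⊆xs++ys R P)) R⊢Q)
            (All.tabulate (λ p∈P → ref (xs⊆ys++xs P R p∈P)))

  mutual
    cut : ∀ {B Q R a} → All (Der B R) Q → Der B Q a → Der B R a
    cut R⊢Q (ref a∈Q)      = All.lookup R⊢Q a∈Q
    cut R⊢Q (app r r∈B ds) = app r r∈B (cutPremises R⊢Q ds)

    cutPremises : ∀ {B Q R ps} → All (Der B R) Q → DerPremises B Q ps → DerPremises B R ps
    cutPremises R⊢Q []                     = []
    cutPremises R⊢Q (_∷_ {x = P , _} d ds) = cut (cut-++ P R⊢Q) d ∷ cutPremises R⊢Q ds

  data WithAxioms (B : Base At) (P : List At) : Base At where
    rule  : ∀ {r} → B r → WithAxioms B P r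
    axiom : ∀ {p} → p ∈ P → WithAxioms B P ([] ⇒ p)

  supports-axioms : ∀ B P → All (Supp (WithAxioms B P)) P
  supports-axioms B P = All.tabulate (λ p∈P → app _ (axiom p∈P) [])

  mutual
    discharge : ∀ {B P Q a} → Der (WithAxioms B P) Q a → Der B (P ++ Q) a
    discharge {P = P} (ref a∈Q)              = ref (xs⊆ys++xs _ P a∈Q)
    discharge (app r (rule r∈B) ds)          = app r r∈B (dischargePremises ds)
    discharge {Q = Q} (app _ (axiom p∈P) []) = ref (xs⊆xs++ys _ Q p∈P)

    dischargePremises : ∀ {B P Q ps} →
                        DerPremises (WithAxioms B P) Q ps → DerPremises B (P ++ Q) ps
    dischargePremises []                                  = []
    dischargePremises {B} {P} {Q} (_∷_ {x = R , _} d ds) =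
      subst (λ Γ → Der B Γ _) (sym (++-assoc P Q R)) (discharge d) ∷ dischargePremises ds

  soundness : ∀ {B} P {a} → Der B P a → Forces P B a
  soundness []      d            = lift d
  soundness (_ ∷ _) d C B⊆C ⊢P = cut ⊢P (mono B⊆C d)

  completeness : ∀ {B} P {a} → Forces P B a → Der B P a
  completeness []             ⊩a = lower ⊩a
  completeness {B} P@(_ ∷ _) {a} ⊩a =
    subst (λ Γ → Der B Γ a) (++-identityʳ P)
          (discharge (⊩a (WithAxioms B P) (λ _ → rule) (supports-axioms B P)))

lemma5 : {At : Set} (B : Base At) (P : List At) (a : At) →
    Forces P B a ⇔ Der B P a
lemma5 B P a = mk⇔ (completeness P) (soundness P)
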